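{- Let $G$ be a connected graph with vertex set $\{1,\dots,n\}$, $n\ge 2$, let $\Phi=(F_1,\dots,F_n)$ be an $n$-tuple of pairwise disjoint graphs with $|V(F_i)|\ge 2$ for all $i$, and let $G[\Phi]$ be the generalized lexicographic product. If $G[\Phi]$ is well $\gamma$-dominated, then $|R|+|I_R|=\gamma(G[\Phi])$ for every minimal dominating set $R$ of $G$.
   Context: All graphs are finite, simple and undirected. The generalized lexicographic product $G[\Phi]$ is the graph with vertex set $\bigcup_{i=1}^n V(F_i)$ in which each $F_i$ is an induced subgraph, and for $x\in V(F_i)$, $y\in V(F_j)$ with $i\neq j$, $xy$ is an edge iff $ij\in E(G)$. A dominating set is a set $D$ such that every vertex outside $D$ has a neighbor in $D$; it is minimal if no proper subset is dominating. $\gamma(H)$ is the minimum and $\Gamma(H)$ the maximum cardinality of a minimal dominating set of $H$; $H$ is well $\gamma$-dominated if $\gamma(H)=\Gamma(H)$. For a minimal dominating set $R$ of $G$, $I_R=\{i\in R: i \text{ is an isolated vertex of } \langle R\rangle \text{ and } \gamma(F_i)\ge 2\}$. -}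

module Defs where

open import Level using (0ℓ)
open import Data.Nat using (ℕ; _≤_; _<_)
open import Data.Fin using (Fin)
open import Data.Product using (Σ; ∃-syntax; _×_; _,_)
open import Data.Sum using (_⊎_)
open import Data.List using (List; length)
open import Data.List.Membership.Propositional using (_∈_)
open import Data.List.Relation.Binary.Subset.Propositional using (_⊆_)
open import Data.List.Relation.Unary.Unique.Propositional using (Unique)
open import Relation.Nullary using (¬_)
open import Relation.Binary.PropositionalEquality using (_≡_; _≢_)
open import Relation.Binary.Construct.Closure.ReflexiveTransitive using (Star)

Graph : Set → Set₁
Graph V = V → V → Set

IsSimple : {V : Set} → Graph V → Set
IsSimple {V} E = (∀ {u v : V} → E u v → E v u) × (∀ {u : V} → ¬ E u u)

IsConnected : {V : Set} → Graph V → Set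
IsConnected {V} E = ∀ (u v : V) → Star E u v

-- A vertex subset is represented by a duplicate-free list; its cardinality is its length.
IsDominating : {V : Set} → Graph V → List V → Set
IsDominating {V} E D = ∀ (v : V) → v ∈ D ⊎ (∃[ u ] (u ∈ D × E u v))

IsMinimalDominating : {V : Set} → Graph V → List V → Set
IsMinimalDominating {V} E D =
  Unique D × IsDominating E D ×
  (∀ (D' : List V) → Unique D' → D' ⊆ D → length D' < length D → ¬ IsDominating E D')

IsGamma : {V : Set} → Graph V → ℕ → Set
IsGamma {V} E k =
  (∃[ D ] (IsMinimalDominating E D × length D ≡ k)) ×
  (∀ (D : List V) → IsMinimalDominating E D → k ≤ length D)

IsUpperGamma : {V : Set} → Graph V → ℕ → Set
IsUpperGamma {V} E k =
  (∃[ D ] (IsMinimalDominating E D × length D ≡ k)) ×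
  (∀ (D : List V) → IsMinimalDominating E D → length D ≤ k)

WellGammaDominated : {V : Set} → Graph V → Set
WellGammaDominated E = ∀ a b → IsGamma E a → IsUpperGamma E b → a ≡ b

-- generalized lexicographic product G[Φ]; F i has vertex set Fin (m i),
-- and the (disjoint) union of the V(F i) is the Σ-type.
data LexAdj {n : ℕ} {m : Fin n → ℕ} (G : Graph (Fin n)) (F : (i : Fin n) → Graph (Fin (m i)))
     : Σ (Fin n) (λ i → Fin (m i)) → Σ (Fin n) (λ i → Fin (m i)) → Set where
  inner : ∀ {i x y} → F i x y → LexAdj G F (i , x) (i , y)
  outer : ∀ {i j x y} → i ≢ j → G i j → LexAdj G F (i , x) (j , y)

GenLex : {n : ℕ} {m : Fin n → ℕ} (G : Graph (Fin n)) (F : (i : Fin n) → Graph (Fin (m i)))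
       → Graph (Σ (Fin n) (λ i → Fin (m i)))
GenLex G F = LexAdj G F

IsolatedIn : {V : Set} → Graph V → List V → V → Set
IsolatedIn {V} E R i = i ∈ R × (∀ (j : V) → j ∈ R → ¬ E i j)

InI : {n : ℕ} {m : Fin n → ℕ} (G : Graph (Fin n)) (F : (i : Fin n) → Graph (Fin (m i)))
    → List (Fin n) → Fin n → Set
InI G F R i = IsolatedIn G R i × (∀ k → IsGamma (F i) k → 2 ≤ k)

module Submission where

-- Blow each vertex i of a minimal dominating set R of G up to a set inside the copy of F_i: a
-- minimal dominating set of F_i when i ∈ I_R (it has at least two vertices, since F_i then has no
-- dominating vertex), and otherwise a single vertex, dominating F_i if possible.  The result is a
-- minimal dominating set of G[Φ] with at least |R| + |I_R| vertices, so |R| + |I_R| ≤ Γ.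
-- Conversely one vertex in each copy over R, together with one vertex in a copy adjacent to F_i
-- for each i ∈ I_R, dominates G[Φ], so γ ≤ |R| + |I_R|; and γ = Γ.
-- Adjacency is an arbitrary type, so its decidability and the existence of extremal dominating sets
-- hold only under ¬¬; as the conclusion is a decidable equation in ℕ, the argument runs in the
-- double-negation monad.

open import Defs
open import Level using (0ℓ)
open import Function using (_∘_)
open import Effect.Monad using (RawMonad)
open import Data.Nat using (ℕ; zero; suc; _+_; _∸_; _≤_; _<_; z≤n; s≤s)
open import Data.Nat.Properties
  using (_≟_; ≤-trans; +-monoʳ-≤; ≤-antisym; <⇒≱; ≮⇒≥; ∸-monoʳ-<; +-mono-≤; +-suc; module ≤-Reasoning)
open import Data.Nat.Induction using (<-rec)
open import Data.Fin using (Fin; zero; suc; fromℕ<) renaming (_≟_ to _≟ᶠ_)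
import Data.Fin.Properties as Fin
open import Data.Product using (Σ; ∃-syntax; _×_; _,_; proj₁; proj₂; map₁)
open import Data.Product.Properties using (≡-dec)
open import Data.Sum using (_⊎_; inj₁; inj₂)
open import Data.Empty using (⊥-elim)
open import Data.List using (List; []; _∷_; [_]; length; filter; map; _++_; deduplicate; allFin)
open import Data.List.Properties
  using (filter-notAll; filter-accept; filter-reject; length-++; length-map; length-deduplicate)
open import Data.List.Membership.Propositional using (_∈_; _∉_; find; lose)
open import Data.List.Membership.Propositional.Properties
  using (∈-filter⁺; ∈-filter⁻; ∈-map⁺; ∈-map⁻; ∈-++⁺ˡ; ∈-++⁺ʳ; ∈-++⁻; ∈-allFin; ∈-deduplicate⁺; ∈-length)
open import Data.List.Relation.Binary.Subset.Propositional using (_⊆_)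
open import Data.List.Relation.Unary.All as All using (all?)
open import Data.List.Relation.Unary.All.Properties using (¬All⇒Any¬)
open import Data.List.Relation.Unary.Any as Any using (here; there; any?)
open import Data.List.Relation.Unary.AllPairs using ([]; _∷_)
open import Data.List.Relation.Unary.Unique.Propositional using (Unique)
import Data.List.Relation.Unary.Unique.Propositional.Properties as Unique
open import Data.List.Relation.Unary.Unique.DecPropositional.Properties using (deduplicate-!)
open import Relation.Nullary using (¬_; Dec; yes; no; ¬?; contradiction)
open import Relation.Nullary.Decidable using (_⊎-dec_; map′; decidable-stable; ¬¬-excluded-middle)
open import Relation.Nullary.Negation using (¬¬-Monad)
open import Relation.Unary using (Pred) renaming (Decidable to Decidableᵘ)
open import Relation.Binary.Definitions using (Decidable; DecidableEquality)
open import Relation.Binary.PropositionalEquality using (_≡_; _≢_; ≢-sym; refl; sym; trans; cong; cong₂; subst)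
open import Relation.Binary.Construct.Closure.ReflexiveTransitive using (Star; ε; _◅_)

open RawMonad (¬¬-Monad {0ℓ})

¬¬-least : (P : ℕ → Set) {t : ℕ} → P t → ¬ ¬ (∃[ b ] (P b × (∀ s → P s → b ≤ s)))
¬¬-least P {t} Pt noLeast = <-rec (λ t → ¬ P t) absent t Pt
  where
  absent : ∀ t → (∀ {s} → s < t → ¬ P s) → ¬ P t
  absent t below Pt = noLeast (t , Pt , λ s Ps → ≮⇒≥ (λ s<t → below s<t Ps))

¬¬-greatest : (P : ℕ → Set) (N : ℕ) → (∀ s → P s → s ≤ N) →
              {t : ℕ} → P t → ¬ ¬ (∃[ b ] (P b × (∀ s → P s → s ≤ b)))
¬¬-greatest P N bounded {t} Pt noGreatest =
  <-rec (λ d → ∀ t → N ∸ t ≡ d → ¬ P t) absent (N ∸ t) t refl Pt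
  where
  absent : ∀ d → (∀ {e} → e < d → ∀ t → N ∸ t ≡ e → ¬ P t) → ∀ t → N ∸ t ≡ d → ¬ P t
  absent _ above t refl Pt = noGreatest (t , Pt , λ s Ps →
    ≮⇒≥ (λ t<s → above (∸-monoʳ-< t<s (bounded s Ps)) s refl Ps))

¬¬-∀-Fin : ∀ n {P : Fin n → Set} → (∀ i → ¬ ¬ P i) → ¬ ¬ (∀ i → P i)
¬¬-∀-Fin zero    _ = pure λ ()
¬¬-∀-Fin (suc n) h = do
  p₀ ← h zero
  ps ← ¬¬-∀-Fin n (h ∘ suc)
  pure λ { zero → p₀ ; (suc i) → ps i }

¬¬-decidable : ∀ {n} (E : Graph (Fin n)) → ¬ ¬ Decidable E
¬¬-decidable {n} E = ¬¬-∀-Fin n λ u → ¬¬-∀-Fin n λ v → ¬¬-excluded-middle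

module _ {A : Set} (_≟ᴬ_ : DecidableEquality A) where
  open import Data.List.Membership.DecPropositional _≟ᴬ_ using (_∈?_)

  Unique-length-≤ : ∀ {xs ys : List A} → Unique xs → xs ⊆ ys → length xs ≤ length ys
  Unique-length-≤ {[]}     _           _     = z≤n
  Unique-length-≤ {x ∷ xs} {ys} (x∉xs ∷ u) x∷xs⊆ys =
    ≤-trans (s≤s (Unique-length-≤ u xs⊆ys∖x))
            (filter-notAll ≢x ys (Any.map (λ x≡y y≢x → y≢x (sym x≡y)) (x∷xs⊆ys (here refl))))
    where
    ≢x : Decidableᵘ (λ y → y ≢ x)
    ≢x y = ¬? (y ≟ᴬ x)
    xs⊆ys∖x : xs ⊆ filter ≢x ys
    xs⊆ys∖x z∈xs = ∈-filter⁺ ≢x (x∷xs⊆ys (there z∈xs)) (≢-sym (All.lookup x∉xs z∈xs))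

  shorter⇒∃∉ : ∀ {xs ys : List A} → Unique xs → length ys < length xs → ∃[ x ] (x ∈ xs × x ∉ ys)
  shorter⇒∃∉ {xs} {ys} uxs shorter with all? (_∈? ys) xs
  ... | yes xs⊆ys = contradiction (Unique-length-≤ uxs (All.lookup xs⊆ys)) (<⇒≱ shorter)
  ... | no  xs⊈ys = find (¬All⇒Any¬ (_∈? ys) xs xs⊈ys)

Dominates : {V : Set} → Graph V → List V → V → Set
Dominates E D v = v ∈ D ⊎ ∃[ u ] (u ∈ D × E u v)

module Domination {V : Set} (_≟ᵛ_ : DecidableEquality V) (E : Graph V) where

  Private : List V → V → V → Set
  Private D d z = ∀ {u} → u ∈ D → u ≡ z ⊎ E u z → u ≡ d

  private⇒minimal : ∀ {D} → Unique D → IsDominating E D →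
                    (∀ {d} → d ∈ D → ∃[ z ] Private D d z) → IsMinimalDominating E D
  private⇒minimal {D} uD domD private-neighbour = uD , domD , noSmaller
    where
    noSmaller : ∀ D' → Unique D' → D' ⊆ D → length D' < length D → ¬ IsDominating E D'
    noSmaller D' _ D'⊆D shorter domD' with shorter⇒∃∉ _≟ᵛ_ uD shorter
    ... | d , d∈D , d∉D' with private-neighbour d∈D
    ... | z , z-private = d∉D' (dominator≡d (domD' z))
      where
      dominator≡d : Dominates E D' z → d ∈ D'
      dominator≡d (inj₁ z∈D')             = subst (_∈ D') (z-private (D'⊆D z∈D') (inj₁ refl)) z∈D'
      dominator≡d (inj₂ (u , u∈D' , Euz)) = subst (_∈ D') (z-private (D'⊆D u∈D') (inj₂ Euz)) u∈D'

  deduplicate-dominating : ∀ {D} → IsDominating E D → IsDominating E (deduplicate _≟ᵛ_ D)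
  deduplicate-dominating domD v with domD v
  ... | inj₁ v∈D             = inj₁ (∈-deduplicate⁺ _≟ᵛ_ v∈D)
  ... | inj₂ (u , u∈D , Euv) = inj₂ (u , ∈-deduplicate⁺ _≟ᵛ_ u∈D , Euv)

  ¬¬-minimum-dominating : ∀ {D} → Unique D → IsDominating E D →
                          ¬ ¬ (∃[ M ] (IsMinimalDominating E M × length M ≤ length D))
  ¬¬-minimum-dominating {D} uD domD = do
    (_ , (M , uM , domM , refl) , least) ← ¬¬-least Size (D , uD , domD , refl)
    let minM = uM , domM , λ D' uD' _ shorter domD' → <⇒≱ shorter (least _ (D' , uD' , domD' , refl))
    pure (M , minM , least _ (D , uD , domD , refl))
    where
    Size : ℕ → Set
    Size t = ∃[ D ] (Unique D × IsDominating E D × length D ≡ t)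

  ¬¬-upperGamma : ∀ {vs} → (∀ v → v ∈ vs) → ∀ {D} → IsMinimalDominating E D → ¬ ¬ (∃[ b ] IsUpperGamma E b)
  ¬¬-upperGamma {vs} complete minD = do
    (_ , (M , minM , refl) , greatest) ← ¬¬-greatest Size (length vs) bounded (_ , minD , refl)
    pure (length M , (M , minM , refl) , λ D' minD' → greatest _ (D' , minD' , refl))
    where
    Size : ℕ → Set
    Size t = ∃[ D ] (IsMinimalDominating E D × length D ≡ t)
    bounded : ∀ t → Size t → t ≤ length vs
    bounded _ (D , (uD , _) , refl) = Unique-length-≤ _≟ᵛ_ uD (λ {v} _ → complete v)

  wellGammaDominated-sandwich : ∀ {vs} → (∀ v → v ∈ vs) → WellGammaDominated E → ∀ {k t} → IsGamma E k →
    ∃[ D ] (IsMinimalDominating E D × t ≤ length D) →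
    ∃[ D ] (Unique D × IsDominating E D × length D ≤ t) →
    ¬ ¬ (t ≡ k)
  wellGammaDominated-sandwich complete wgd {k} {t} γk (D₁ , minD₁ , t≤D₁) (D₂ , uD₂ , domD₂ , D₂≤t) = do
    (b , Γb) ← ¬¬-upperGamma complete minD₁
    (M , minM , M≤D₂) ← ¬¬-minimum-dominating uD₂ domD₂
    let open ≤-Reasoning
    pure (≤-antisym
      (begin t ≤⟨ t≤D₁ ⟩ length D₁ ≤⟨ proj₂ Γb D₁ minD₁ ⟩ b ≡⟨ sym (wgd k b γk Γb) ⟩ k ∎)
      (begin k ≤⟨ proj₂ γk M minM ⟩ length M ≤⟨ M≤D₂ ⟩ length D₂ ≤⟨ D₂≤t ⟩ t ∎))

module _ {n : ℕ} (E : Graph (Fin n)) where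
  open Domination _≟ᶠ_ E

  ¬¬-minimalDominating : ¬ ¬ (∃[ M ] IsMinimalDominating E M)
  ¬¬-minimalDominating = do
    (M , minM , _) ← ¬¬-minimum-dominating (Unique.allFin⁺ n) (λ v → inj₁ (∈-allFin v))
    pure (M , minM)

  module _ (E? : Decidable E) where
    open import Data.List.Membership.DecPropositional (_≟ᶠ_ {n}) using (_∈?_)

    dominates? : ∀ D → Decidableᵘ (Dominates E D)
    dominates? D z = z ∈? D ⊎-dec map′ find (λ (u , u∈D , Euz) → lose u∈D Euz) (any? (λ u → E? u z) D)

    minimal⇒private : ∀ {D} → IsMinimalDominating E D → ∀ {d} → d ∈ D → ∃[ z ] Private D d z
    minimal⇒private {D} (uD , _ , minimal) {d} d∈D = z , z-private
      where
      ≢d : Decidableᵘ (λ u → ¬ u ≡ d)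
      ≢d u = ¬? (u ≟ᶠ d)
      D∖d : List (Fin n)
      D∖d = filter ≢d D
      D∖d-undominating : ¬ IsDominating E D∖d
      D∖d-undominating = minimal D∖d (Unique.filter⁺ ≢d uD) (proj₁ ∘ ∈-filter⁻ ≢d)
        (filter-notAll ≢d D (Any.map (λ d≡u u≢d → u≢d (sym d≡u)) d∈D))
      undominated : ∃[ z ] ¬ Dominates E D∖d z
      undominated = Fin.¬∀⟶∃¬ n (Dominates E D∖d) (dominates? D∖d) D∖d-undominating
      z = proj₁ undominated
      z-private : Private D d z
      z-private {u} u∈D u-dominates-z with u ≟ᶠ d
      ... | yes u≡d = u≡d
      ... | no  u≢d = ⊥-elim (proj₂ undominated (lift u-dominates-z))
        where
        u∈D∖d : u ∈ D∖d
        u∈D∖d = ∈-filter⁺ ≢d u∈D u≢d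
        lift : u ≡ z ⊎ E u z → Dominates E D∖d z
        lift (inj₁ refl) = inj₁ u∈D∖d
        lift (inj₂ Euz)  = inj₂ (u , u∈D∖d , Euz)

module _ {V : Set} (E : Graph V) where

  IsDominatingVertex : V → Set
  IsDominatingVertex v = ∀ w → v ≡ w ⊎ E v w

  []-undominating : V → ¬ IsDominating E []
  []-undominating v dom with dom v
  ... | inj₁ ()
  ... | inj₂ (_ , () , _)

  dominatingVertex⇒[v]-dominating : ∀ {v} → IsDominatingVertex v → IsDominating E [ v ]
  dominatingVertex⇒[v]-dominating {v} dv w with dv w
  ... | inj₁ refl = inj₁ (here refl)
  ... | inj₂ Evw  = inj₂ (v , here refl , Evw)

  dominatingVertex⇒γ≡1 : ∀ {v} → IsDominatingVertex v → IsGamma E 1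
  dominatingVertex⇒γ≡1 {v} dv = ([ v ] , minimal , refl) , nonempty
    where
    minimal : IsMinimalDominating E [ v ]
    minimal = (All.[] ∷ []) , dominatingVertex⇒[v]-dominating dv , λ where
      []      _ _ _         → []-undominating v
      (_ ∷ _) _ _ (s≤s ()) _
    nonempty : ∀ D → IsMinimalDominating E D → 1 ≤ length D
    nonempty []      (_ , dom , _) = ⊥-elim ([]-undominating v dom)
    nonempty (_ ∷ _) _             = s≤s z≤n

  no-dominatingVertex⇒2≤length : V → (∀ v → ¬ IsDominatingVertex v) → ∀ {D} → IsDominating E D → 2 ≤ length D
  no-dominatingVertex⇒2≤length x noDV {[]}         dom = ⊥-elim ([]-undominating x dom)
  no-dominatingVertex⇒2≤length x noDV {v ∷ []}     dom = ⊥-elim (noDV v λ w → centred (dom w))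
    where
    centred : ∀ {w} → Dominates E [ v ] w → v ≡ w ⊎ E v w
    centred (inj₁ (here refl))           = inj₁ refl
    centred (inj₂ (_ , here refl , Evw)) = inj₂ Evw
  no-dominatingVertex⇒2≤length x noDV {_ ∷ _ ∷ _} _   = s≤s (s≤s z≤n)

connected⇒neighbour : ∀ {n} → 2 ≤ n → {G : Graph (Fin n)} → IsConnected G → ∀ i → ∃[ j ] G i j
connected⇒neighbour {suc zero}    (s≤s ())
connected⇒neighbour {suc (suc n)} _ {G} connected i = first-step (connected i (other i)) (other≢ i)
  where
  other : Fin (suc (suc n)) → Fin (suc (suc n))
  other zero    = suc zero
  other (suc _) = zero
  other≢ : ∀ i → i ≢ other i
  other≢ zero    ()
  other≢ (suc _) ()
  first-step : ∀ {w} → Star G i w → i ≢ w → ∃[ j ] G i j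
  first-step ε         i≢i = ⊥-elim (i≢i refl)
  first-step (Gij ◅ _) _   = _ , Gij

module _ {n : ℕ} {m : Fin n → ℕ} where

  inCopy : (i : Fin n) → Fin (m i) → Σ (Fin n) (λ i → Fin (m i))
  inCopy i x = i , x

  blowUp : ((i : Fin n) → List (Fin (m i))) → List (Fin n) → List (Σ (Fin n) (λ i → Fin (m i)))
  blowUp T []       = []
  blowUp T (i ∷ is) = map (inCopy i) (T i) ++ blowUp T is

  ∈-blowUp⁺ : ∀ T {is j y} → j ∈ is → y ∈ T j → (j , y) ∈ blowUp T is
  ∈-blowUp⁺ T {i ∷ _}  (here refl) y∈ = ∈-++⁺ˡ (∈-map⁺ (inCopy i) y∈)
  ∈-blowUp⁺ T {i ∷ is} (there j∈)  y∈ = ∈-++⁺ʳ (map (inCopy i) (T i)) (∈-blowUp⁺ T j∈ y∈)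

  ∈-blowUp⁻ : ∀ T is {j y} → (j , y) ∈ blowUp T is → j ∈ is × y ∈ T j
  ∈-blowUp⁻ T (i ∷ is) jy∈ with ∈-++⁻ (map (inCopy i) (T i)) jy∈
  ... | inj₁ jy∈i×Ti with ∈-map⁻ (inCopy i) jy∈i×Ti
  ...   | _ , y∈ , refl = here refl , y∈
  ∈-blowUp⁻ T (i ∷ is) jy∈ | inj₂ jy∈rest = map₁ there (∈-blowUp⁻ T is jy∈rest)

  blowUp-unique : ∀ T {is} → Unique is → (∀ i → Unique (T i)) → Unique (blowUp T is)
  blowUp-unique T {[]}     _            _  = []
  blowUp-unique T {i ∷ is} (i∉is ∷ uis) uT =
    Unique.++⁺ (Unique.map⁺ ,-injective (uT i)) (blowUp-unique T uis uT) disjoint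
    where
    ,-injective : ∀ {x y} → _≡_ {A = Σ (Fin n) (λ i → Fin (m i))} (i , x) (i , y) → x ≡ y
    ,-injective refl = refl
    disjoint : ∀ {v} → ¬ (v ∈ map (inCopy i) (T i) × v ∈ blowUp T is)
    disjoint (v∈i×Ti , v∈rest) with ∈-map⁻ (inCopy i) v∈i×Ti
    ... | _ , _ , refl = All.lookup i∉is (proj₁ (∈-blowUp⁻ T is v∈rest)) refl

  length-blowUp-∷ : ∀ T i is → length (blowUp T (i ∷ is)) ≡ length (T i) + length (blowUp T is)
  length-blowUp-∷ T i is =
    trans (length-++ (map (inCopy i) (T i))) (cong (_+ length (blowUp T is)) (length-map (inCopy i) (T i)))

  blowUp-length-≥ : ∀ {P : Pred (Fin n) 0ℓ} (P? : Decidableᵘ P) T →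
    (∀ i → 1 ≤ length (T i)) → (∀ {i} → P i → 2 ≤ length (T i)) →
    ∀ is → length is + length (filter P? is) ≤ length (blowUp T is)
  blowUp-length-≥ P? T T≥1 T≥2 []       = z≤n
  blowUp-length-≥ {P} P? T T≥1 T≥2 (i ∷ is) = count (P? i)
    where
    open ≤-Reasoning
    ih : length is + length (filter P? is) ≤ length (blowUp T is)
    ih = blowUp-length-≥ P? T T≥1 T≥2 is
    count : Dec (P i) → length (i ∷ is) + length (filter P? (i ∷ is)) ≤ length (blowUp T (i ∷ is))
    count (yes Pi) = begin
      suc (length is + length (filter P? (i ∷ is)))  ≡⟨ cong (λ xs → suc (length is + length xs)) (filter-accept P? Pi) ⟩
      suc (length is + suc (length (filter P? is)))  ≡⟨ cong suc (+-suc (length is) _) ⟩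
      2 + (length is + length (filter P? is))        ≤⟨ +-mono-≤ (T≥2 Pi) ih ⟩
      length (T i) + length (blowUp T is)            ≡⟨ sym (length-blowUp-∷ T i is) ⟩
      length (blowUp T (i ∷ is))                     ∎
    count (no ¬Pi) = begin
      suc (length is + length (filter P? (i ∷ is)))  ≡⟨ cong (λ xs → suc (length is + length xs)) (filter-reject P? ¬Pi) ⟩
      1 + (length is + length (filter P? is))        ≤⟨ +-mono-≤ (T≥1 i) ih ⟩
      length (T i) + length (blowUp T is)            ≡⟨ sym (length-blowUp-∷ T i is) ⟩
      length (blowUp T (i ∷ is))                     ∎

module LexicographicProduct
  {n : ℕ} {m : Fin n → ℕ} (x₀ : ∀ i → Fin (m i))
  {G : Graph (Fin n)} (G-simple : IsSimple G) (G? : Decidable G) (neighbour : ∀ i → ∃[ j ] G i j)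
  {F : (i : Fin n) → Graph (Fin (m i))} (F? : ∀ i → Decidable (F i))
  {R : List (Fin n)} (R-minimal : IsMinimalDominating G R)
  {I : List (Fin n)} (I-unique : Unique I) (I-spec : ∀ i → (i ∈ I → InI G F R i) × (InI G F R i → i ∈ I))
  where

  open import Data.List.Membership.DecPropositional (_≟ᶠ_ {n}) using (_∈?_)

  Vertex : Set
  Vertex = Σ (Fin n) (λ i → Fin (m i))

  E : Graph Vertex
  E = GenLex G F

  _≟ᵛ_ : DecidableEquality Vertex
  _≟ᵛ_ = ≡-dec _≟ᶠ_ _≟ᶠ_

  open Domination _≟ᵛ_ E using (Private; private⇒minimal; deduplicate-dominating; wellGammaDominated-sandwich) public

  vertices : List Vertex
  vertices = blowUp (λ i → allFin (m i)) (allFin n)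

  ∈-vertices : ∀ v → v ∈ vertices
  ∈-vertices (i , x) = ∈-blowUp⁺ _ (∈-allFin i) (∈-allFin x)

  adjacent⇒≢ : ∀ {i j} → G i j → i ≢ j
  adjacent⇒≢ Gij refl = proj₂ G-simple Gij

  HasDominatingVertex : Fin n → Set
  HasDominatingVertex i = ∃[ v ] IsDominatingVertex (F i) v

  hasDominatingVertex? : ∀ i → Dec (HasDominatingVertex i)
  hasDominatingVertex? i = Fin.any? λ v → Fin.all? λ w → (v ≟ᶠ w) ⊎-dec F? i v w

  centre : ∀ i → Fin (m i)
  centre i with hasDominatingVertex? i
  ... | yes (v , _) = v
  ... | no  _       = x₀ i

  centre-dominating : ∀ {i} → HasDominatingVertex i → IsDominatingVertex (F i) (centre i)
  centre-dominating {i} hasDV with hasDominatingVertex? i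
  ... | yes (_ , dv) = dv
  ... | no  noDV     = ⊥-elim (noDV hasDV)

  I⊆R : ∀ {i} → i ∈ I → i ∈ R
  I⊆R i∈I = proj₁ (proj₁ (proj₁ (I-spec _) i∈I))

  I-isolated : ∀ {i j} → i ∈ I → j ∈ R → ¬ G j i
  I-isolated i∈I j∈R = proj₂ (proj₁ (proj₁ (I-spec _) i∈I)) _ j∈R ∘ proj₁ G-simple

  I-no-dominatingVertex : ∀ {i} → i ∈ I → ¬ HasDominatingVertex i
  I-no-dominatingVertex i∈I (_ , dv) with proj₂ (proj₁ (I-spec _) i∈I) 1 (dominatingVertex⇒γ≡1 (F _) dv)
  ... | s≤s ()

  isolated⇒∈I : ∀ {i} → i ∈ R → (∀ {j} → j ∈ R → ¬ G j i) → ¬ HasDominatingVertex i → i ∈ I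
  isolated⇒∈I {i} i∈R isolated noDV = proj₂ (I-spec i)
    ( (i∈R , λ j j∈R → isolated j∈R ∘ proj₁ G-simple)
    , λ where
        _ ((_ , (_ , domD , _) , refl) , _) →
          no-dominatingVertex⇒2≤length (F i) (x₀ i) (λ v dv → noDV (v , dv)) domD)

  data Coverage (l : Fin n) : Set where
    by-neighbour : ∀ {j} → j ∈ R → G j l → Coverage l
    by-I         : l ∈ I → Coverage l
    by-centre    : l ∈ R → l ∉ I → HasDominatingVertex l → Coverage l

  coverage : ∀ l → Coverage l
  coverage l with proj₁ (proj₂ R-minimal) l | l ∈? I
  ... | _                    | yes l∈I = by-I l∈I
  ... | inj₂ (_ , j∈R , Gjl) | no  _   = by-neighbour j∈R Gjl
  ... | inj₁ l∈R             | no  l∉I with any? (λ j → G? j l) R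
  ...   | yes R-neighbour = let (_ , j∈R , Gjl) = find R-neighbour in by-neighbour j∈R Gjl
  ...   | no  isolated    with hasDominatingVertex? l
  ...     | yes hasDV = by-centre l∈R l∉I hasDV
  ...     | no  noDV  = ⊥-elim (l∉I (isolated⇒∈I l∈R (λ j∈R Gjl → isolated (lose j∈R Gjl)) noDV))

  module Large (M : ∀ i → ∃[ S ] IsMinimalDominating (F i) S) where

    fibre : ∀ i → List (Fin (m i))
    fibre i with i ∈? I
    ... | yes _ = proj₁ (M i)
    ... | no  _ = [ centre i ]

    fibre-I : ∀ {i} → i ∈ I → fibre i ≡ proj₁ (M i)
    fibre-I {i} i∈I with i ∈? I
    ... | yes _   = refl
    ... | no  i∉I = contradiction i∈I i∉I

    fibre-∉I : ∀ {i} → i ∉ I → fibre i ≡ [ centre i ]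
    fibre-∉I {i} i∉I with i ∈? I
    ... | yes i∈I = contradiction i∈I i∉I
    ... | no  _   = refl

    fibre-minimal : ∀ {i} → i ∈ I → IsMinimalDominating (F i) (fibre i)
    fibre-minimal {i} i∈I = subst (IsMinimalDominating (F i)) (sym (fibre-I i∈I)) (proj₂ (M i))

    fibre-unique : ∀ i → Unique (fibre i)
    fibre-unique i with i ∈? I
    ... | yes _ = proj₁ (proj₂ (M i))
    ... | no  _ = All.[] ∷ []

    fibre-inhabited : ∀ i → ∃[ y ] y ∈ fibre i
    fibre-inhabited i with i ∈? I
    ... | no  _ = centre i , here refl
    ... | yes _ with proj₁ (proj₂ (proj₂ (M i))) (x₀ i)
    ...   | inj₁ x₀∈          = x₀ i , x₀∈
    ...   | inj₂ (y , y∈ , _) = y , y∈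

    D : List Vertex
    D = blowUp fibre R

    lift-dominating : ∀ {l} → l ∈ R → IsDominating (F l) (fibre l) → ∀ x → Dominates E D (l , x)
    lift-dominating l∈R dom x with dom x
    ... | inj₁ x∈             = inj₁ (∈-blowUp⁺ fibre l∈R x∈)
    ... | inj₂ (y , y∈ , Fyx) = inj₂ ((_ , y) , ∈-blowUp⁺ fibre l∈R y∈ , inner Fyx)

    D-dominating : IsDominating E D
    D-dominating (l , x) with coverage l
    ... | by-neighbour j∈R Gjl =
      let (y , y∈) = fibre-inhabited _ in inj₂ ((_ , y) , ∈-blowUp⁺ fibre j∈R y∈ , outer (adjacent⇒≢ Gjl) Gjl)
    ... | by-I l∈I = lift-dominating (I⊆R l∈I) (proj₁ (proj₂ (fibre-minimal l∈I))) x
    ... | by-centre l∈R l∉I hasDV =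
      lift-dominating l∈R (subst (IsDominating (F l)) (sym (fibre-∉I l∉I))
        (dominatingVertex⇒[v]-dominating (F l) (centre-dominating hasDV))) x

    private-in-I : ∀ {i y} → i ∈ I → y ∈ fibre i → ∃[ z ] Private D (i , y) z
    private-in-I {i} {y} i∈I y∈ with minimal⇒private (F i) (F? i) (fibre-minimal i∈I) y∈
    ... | z , z-private = (i , z) , private-in-copy
      where
      private-in-copy : ∀ {u} → u ∈ D → u ≡ (i , z) ⊎ E u (i , z) → u ≡ (i , y)
      private-in-copy {j , w} u∈D u-dominates with ∈-blowUp⁻ fibre R u∈D | u-dominates
      ... | _   , w∈ | inj₁ refl          = cong (i ,_) (z-private w∈ (inj₁ refl))
      ... | _   , w∈ | inj₂ (inner Fwz)   = cong (i ,_) (z-private w∈ (inj₂ Fwz))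
      ... | j∈R , _  | inj₂ (outer _ Gji) = ⊥-elim (I-isolated i∈I j∈R Gji)

    fibre-∉I-centre : ∀ {i w} → i ∉ I → w ∈ fibre i → w ≡ centre i
    fibre-∉I-centre i∉I w∈ with subst (_ ∈_) (fibre-∉I i∉I) w∈
    ... | here w≡c = w≡c

    private-outside-I : ∀ {i y} → i ∈ R → i ∉ I → y ∈ fibre i → ∃[ z ] Private D (i , y) z
    private-outside-I {i} {y} i∈R i∉I y∈ with minimal⇒private G G? R-minimal i∈R
    ... | p , p-private = (p , x₀ p) , private-via-G
      where
      same-copy : ∀ {j w} → w ∈ fibre j → j ≡ i → (j , w) ≡ (i , y)
      same-copy w∈ refl = cong (i ,_) (trans (fibre-∉I-centre i∉I w∈) (sym (fibre-∉I-centre i∉I y∈)))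
      private-via-G : ∀ {u} → u ∈ D → u ≡ (p , x₀ p) ⊎ E u (p , x₀ p) → u ≡ (i , y)
      private-via-G {j , w} u∈D u-dominates with ∈-blowUp⁻ fibre R u∈D | u-dominates
      ... | j∈R , w∈ | inj₁ refl          = same-copy w∈ (p-private j∈R (inj₁ refl))
      ... | j∈R , w∈ | inj₂ (inner _)     = same-copy w∈ (p-private j∈R (inj₁ refl))
      ... | j∈R , w∈ | inj₂ (outer _ Gjp) = same-copy w∈ (p-private j∈R (inj₂ Gjp))

    D-private : ∀ {d} → d ∈ D → ∃[ z ] Private D d z
    D-private {i , y} d∈D with ∈-blowUp⁻ fibre R d∈D | i ∈? I
    ... | _   , y∈ | yes i∈I = private-in-I i∈I y∈
    ... | i∈R , y∈ | no  i∉I = private-outside-I i∈R i∉I y∈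

    large-minimal : ∃[ D ] (IsMinimalDominating E D × length R + length I ≤ length D)
    large-minimal =
      D , private⇒minimal (blowUp-unique fibre (proj₁ R-minimal) fibre-unique) D-dominating D-private , size
      where
      open ≤-Reasoning
      fibre-≥1 : ∀ i → 1 ≤ length (fibre i)
      fibre-≥1 i = ∈-length (proj₂ (fibre-inhabited i))
      fibre-≥2 : ∀ {i} → i ∈ I → 2 ≤ length (fibre i)
      fibre-≥2 {i} i∈I = no-dominatingVertex⇒2≤length (F i) (x₀ i) (λ v dv → I-no-dominatingVertex i∈I (v , dv))
        (proj₁ (proj₂ (fibre-minimal i∈I)))
      I⊆R∩I : I ⊆ filter (_∈? I) R
      I⊆R∩I i∈I = ∈-filter⁺ (_∈? I) (I⊆R i∈I) i∈I
      size : length R + length I ≤ length D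
      size = begin
        length R + length I                   ≤⟨ +-monoʳ-≤ (length R) (Unique-length-≤ _≟ᶠ_ I-unique I⊆R∩I) ⟩
        length R + length (filter (_∈? I) R)  ≤⟨ blowUp-length-≥ (_∈? I) fibre fibre-≥1 fibre-≥2 R ⟩
        length D                              ∎

  small-dominating : ∃[ D ] (Unique D × IsDominating E D × length D ≤ length R + length I)
  small-dominating = deduplicate _≟ᵛ_ D₀ , deduplicate-! _≟ᵛ_ D₀ , deduplicate-dominating D₀-dominating , size
    where
    beside : Fin n → Vertex
    beside i = proj₁ (neighbour i) , x₀ _
    D₀ : List Vertex
    D₀ = map (λ i → i , centre i) R ++ map beside I
    centre∈ : ∀ {i} → i ∈ R → (i , centre i) ∈ D₀
    centre∈ i∈R = ∈-++⁺ˡ (∈-map⁺ (λ i → i , centre i) i∈R)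
    beside∈ : ∀ {i} → i ∈ I → beside i ∈ D₀
    beside∈ i∈I = ∈-++⁺ʳ (map (λ i → i , centre i) R) (∈-map⁺ beside i∈I)
    D₀-dominating : IsDominating E D₀
    D₀-dominating (l , x) with coverage l
    ... | by-neighbour j∈R Gjl = inj₂ (_ , centre∈ j∈R , outer (adjacent⇒≢ Gjl) Gjl)
    ... | by-I l∈I =
      let Gjl = proj₁ G-simple (proj₂ (neighbour l)) in inj₂ (beside l , beside∈ l∈I , outer (adjacent⇒≢ Gjl) Gjl)
    ... | by-centre l∈R _ hasDV with centre-dominating hasDV x
    ...   | inj₁ refl = inj₁ (centre∈ l∈R)
    ...   | inj₂ Fcx  = inj₂ (_ , centre∈ l∈R , inner Fcx)
    size : length (deduplicate _≟ᵛ_ D₀) ≤ length R + length I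
    size = begin
      length (deduplicate _≟ᵛ_ D₀)                                   ≤⟨ length-deduplicate _≟ᵛ_ D₀ ⟩
      length D₀                                                      ≡⟨ length-++ (map (λ i → i , centre i) R) ⟩
      length (map (λ i → i , centre i) R) + length (map beside I)  ≡⟨ cong₂ _+_ (length-map _ R) (length-map beside I) ⟩
      length R + length I                                            ∎
      where open ≤-Reasoning

corollary3p7 : (n : ℕ) → 2 ≤ n → (m : Fin n → ℕ) → (∀ i → 2 ≤ m i)
    → (G : Graph (Fin n)) → IsSimple G → IsConnected G
    → (F : (i : Fin n) → Graph (Fin (m i))) → (∀ i → IsSimple (F i))
    → WellGammaDominated (GenLex G F)
    → (R : List (Fin n)) → IsMinimalDominating G R
    → (I : List (Fin n)) → Unique I → (∀ i → (i ∈ I → InI G F R i) × (InI G F R i → i ∈ I))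
    → (k : ℕ) → IsGamma (GenLex G F) k
    → length R + length I ≡ k
corollary3p7 n 2≤n m 2≤m G G-simple G-connected F _ wgd R R-minimal I I-unique I-spec k γk =
  decidable-stable (length R + length I ≟ k) do
    G? ← ¬¬-decidable G
    F? ← ¬¬-∀-Fin n (λ i → ¬¬-decidable (F i))
    M  ← ¬¬-∀-Fin n (λ i → ¬¬-minimalDominating (F i))
    let open LexicographicProduct x₀ G-simple G? (connected⇒neighbour 2≤n G-connected) F? R-minimal I-unique I-spec
    wellGammaDominated-sandwich ∈-vertices wgd γk (Large.large-minimal M) small-dominating
  where
  x₀ : ∀ i → Fin (m i)
  x₀ i = fromℕ< (≤-trans (s≤s z≤n) (2≤m i))
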